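{- Let $G$ be a matching covered graph that contains a complete subgraph $H$. (i) If $|V(H)|\geq 5$, then for any two adjacent edges of $H$, at least one of them is removable in $G$. In particular, if $G$ has no removable edges, then $G$ is $K_5$-free. (ii) Suppose some vertex $u$ of $H$ has exactly one neighbour $w$ in $V(G)\setminus V(H)$. If either $|V(H)|=4$ and every edge of $H$ is nonremovable in $G$, or $|V(H)|=3$, then the edge $uw$ is nonremovable in $G$.
   Context: Graphs may have multiple edges but no loops. Matching covered: connected, at least two vertices, every edge in a perfect matching. An edge $e$ of a matching covered graph $G$ is removable if $G-e$ is matching covered, and nonremovable otherwise. $K_5$-free means no induced subgraph isomorphic to $K_5$. -}

module Defs where

open import Data.Nat using (ℕ; zero; suc)
open import Data.Fin using (Fin; punchIn)
open import Data.Bool using (Bool; true)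
open import Data.Product using (_×_; _,_; proj₁; proj₂; Σ; ∃; ∃-syntax)
open import Data.Sum using (_⊎_)
open import Relation.Binary.PropositionalEquality using (_≡_; _≢_)
open import Relation.Binary.Construct.Closure.ReflexiveTransitive using (Star)
open import Relation.Nullary using (¬_)

-- A (multi)graph without loops: vertex set Fin n, edge set Fin m,
-- each edge has two distinct endpoints; parallel edges are allowed.
record Graph (n m : ℕ) : Set where
  field
    ends     : Fin m → Fin n × Fin n
    loopless : ∀ e → proj₁ (ends e) ≢ proj₂ (ends e)
open Graph public

module _ {n m : ℕ} (G : Graph n m) where

  Joins : Fin m → Fin n → Fin n → Set
  Joins e u v = (proj₁ (ends G e) ≡ u × proj₂ (ends G e) ≡ v)
              ⊎ (proj₁ (ends G e) ≡ v × proj₂ (ends G e) ≡ u)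

  Incident : Fin m → Fin n → Set
  Incident e v = proj₁ (ends G e) ≡ v ⊎ proj₂ (ends G e) ≡ v

  Adj : Fin n → Fin n → Set
  Adj u v = ∃[ e ] Joins e u v

  Connected : Set
  Connected = ∀ u v → Star Adj u v

  IsPerfectMatching : (Fin m → Bool) → Set
  IsPerfectMatching M =
    ∀ v → (∃[ e ] (M e ≡ true × Incident e v))
        × (∀ e e′ → M e ≡ true → M e′ ≡ true → Incident e v → Incident e′ v → e ≡ e′)

  MatchingCovered : Set
  MatchingCovered =
    Connected × (2 Data.Nat.≤ n)
    × (∀ e → ∃[ M ] (IsPerfectMatching M × M e ≡ true))

deleteEdge : ∀ {n m} → Graph n (suc m) → Fin (suc m) → Graph n m
deleteEdge G e = record
  { ends = λ i → ends G (punchIn e i)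
  ; loopless = λ i → loopless G (punchIn e i) }

Removable : ∀ {n m} → Graph n m → Fin m → Set
Removable {m = zero} G ()
Removable {m = suc m} G e = MatchingCovered (deleteEdge G e)

record CompleteSubgraph {n m : ℕ} (G : Graph n m) (k : ℕ) : Set where
  field
    vtx      : Fin k → Fin n
    vtx-inj  : ∀ i j → vtx i ≡ vtx j → i ≡ j
    edge     : (i j : Fin k) → i ≢ j → Fin m
    edge-joins : ∀ i j (p : i ≢ j) → Joins G (edge i j p) (vtx i) (vtx j)
    edge-sym : ∀ i j (p : i ≢ j) (q : j ≢ i) → edge i j p ≡ edge j i q
open CompleteSubgraph public

-- G has an induced subgraph isomorphic to K_5: five distinct vertices
-- with exactly one edge between any two of them.
HasInducedK5 : ∀ {n m} → Graph n m → Set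
HasInducedK5 {n} {m} G =
  Σ (Fin 5 → Fin n) λ f →
    (∀ i j → f i ≡ f j → i ≡ j)
    × (∀ i j → i ≢ j → ∃[ e ] (Joins G e (f i) (f j)
                              × (∀ e′ → Joins G e′ (f i) (f j) → e′ ≡ e)))

K5Free : ∀ {n m} → Graph n m → Set
K5Free G = ¬ HasInducedK5 G

-- An edge e = ij of a matching covered graph G is removable as soon as G - e is connected
-- and every other edge f lies in a perfect matching avoiding e.  Suppose a perfect matching
-- M ∌ e matches two common neighbours a, b of i and j, and let N be a perfect matching
-- through e and f.  Follow the N/M-alternating path that starts with the N-edge ij: it
-- either closes up into an alternating cycle, or it reaches a or b first.  Switching to M
-- along that cycle (or along the cycle closed by a chord from a or b to i), or keeping N
-- along the path but replacing ij by chords ia, jb, gives a perfect matching through f that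
-- avoids e; walks through e detour via a.  In a K₅, adjacent edges ij and il leave two more
-- vertices a, b, and a perfect matching through ab misses ij or il, proving (i).
--
-- For (ii), a perfect matching avoiding the pendant edge uw matches u inside H.  In a
-- triangle this is impossible for a perfect matching through the edge opposite u.  In a K₄
-- whose edges are nonremovable, a perfect matching through one edge also uses the opposite
-- edge; exchanging matching edges for parallel edges of H, this shows first that in a
-- perfect matching through uw the partner a′ of a vertex a ≠ u of H lies outside H, and then
-- that no perfect matching through aa′ can avoid uw.

module Submission where

open import Defs
open import Data.Nat using (ℕ; zero; suc; _≤_; _≥_; _+_; z≤n; s≤s)
open import Data.Nat.Properties using (≤-refl; ≤-trans; ≤-reflexive; +-suc; +-identityʳ; n≤1+n; m≤n+m; <⇒≱)
open import Data.Fin using (Fin; zero; suc; punchIn; punchOut)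
open import Data.Fin.Properties
  using (_≟_; any?; punchIn-injective; punchInᵢ≢i; punchIn-punchOut; punchOut-punchIn; punchOut-cong)
open import Data.Bool using (Bool; true; false; _∨_; _∧_; not; if_then_else_)
open import Data.Bool.Properties using (∨-identityʳ; ¬-not) renaming (_≟_ to _≟ᵇ_)
open import Data.Product using (_×_; _,_; proj₁; proj₂; Σ; ∃)
open import Data.Sum using (_⊎_; inj₁; inj₂; [_,_])
open import Data.Empty using (⊥-elim)
open import Relation.Binary.PropositionalEquality
  using (_≡_; _≢_; refl; sym; trans; cong; cong₂; subst; subst₂; ≢-sym)
open import Relation.Binary.Construct.Closure.ReflexiveTransitive using (Star; ε; _◅_)
open import Relation.Nullary using (¬_; Dec; yes; no)
open import Relation.Nullary.Decidable using (⌊_⌋; _×-dec_)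

_==_ : ∀ {n} → Fin n → Fin n → Bool
u == v = ⌊ u ≟ v ⌋

==⇒≡ : ∀ {n} {u v : Fin n} → (u == v) ≡ true → u ≡ v
==⇒≡ {u = u} {v} h with u ≟ v
... | yes u≡v = u≡v

==-refl : ∀ {n} (u : Fin n) → (u == u) ≡ true
==-refl u with u ≟ u
... | yes _ = refl
... | no u≢u = ⊥-elim (u≢u refl)

≢⇒==-false : ∀ {n} {u v : Fin n} → u ≢ v → (u == v) ≡ false
≢⇒==-false {u = u} {v} u≢v with u ≟ v
... | yes u≡v = ⊥-elim (u≢v u≡v)
... | no _ = refl

==-suc : ∀ {n} (u v : Fin n) → (suc u == suc v) ≡ (u == v)
==-suc u v with u ≟ v
... | yes _ = refl
... | no _ = refl

-- Unlike `with u ≟ v`, splitting on this does not abstract `u ≟ v` inside `_==_`.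
≡⊎≢ : ∀ {n} (u v : Fin n) → u ≡ v ⊎ u ≢ v
≡⊎≢ u v with u ≟ v
... | yes u≡v = inj₁ u≡v
... | no u≢v = inj₂ u≢v

true≢false : ∀ {x} → x ≡ true → x ≢ false
true≢false refl ()

∨-trueˡ : ∀ {x y} → x ≡ true → (x ∨ y) ≡ true
∨-trueˡ refl = refl

∨-trueʳ : ∀ x {y} → y ≡ true → (x ∨ y) ≡ true
∨-trueʳ true _ = refl
∨-trueʳ false h = h

∨-true⁻ : ∀ x {y} → (x ∨ y) ≡ true → x ≡ true ⊎ y ≡ true
∨-true⁻ true _ = inj₁ refl
∨-true⁻ false h = inj₂ h

-- Vertex sets

VSet : ℕ → Set
VSet n = Fin n → Bool

∅ : ∀ {n} → VSet n
∅ _ = false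

insert : ∀ {n} → Fin n → VSet n → VSet n
insert v S u = S u ∨ (u == v)

remove : ∀ {n} → Fin n → VSet n → VSet n
remove v S u = S u ∧ not (u == v)

module _ {n} (v : Fin n) (S : VSet n) where

  insert-here : insert v S v ≡ true
  insert-here = ∨-trueʳ (S v) (==-refl v)

  insert-there : ∀ {u} → S u ≡ true → insert v S u ≡ true
  insert-there = ∨-trueˡ

  insert⁻ : ∀ {u} → insert v S u ≡ true → S u ≡ true ⊎ u ≡ v
  insert⁻ {u} h with ∨-true⁻ (S u) h
  ... | inj₁ u∈S = inj₁ u∈S
  ... | inj₂ u==v = inj₂ (==⇒≡ u==v)

  insert-∉ : ∀ {u} → S u ≡ false → u ≢ v → insert v S u ≡ false
  insert-∉ u∉S u≢v = cong₂ _∨_ u∉S (≢⇒==-false u≢v)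

  insert-∉⁻ : ∀ {u} → insert v S u ≡ false → S u ≡ false × u ≢ v
  insert-∉⁻ h = ¬-not (λ u∈S → true≢false (insert-there u∈S) h)
              , λ { refl → true≢false insert-here h }

  remove⁺ : ∀ {u} → S u ≡ true → u ≢ v → remove v S u ≡ true
  remove⁺ u∈S u≢v rewrite u∈S | ≢⇒==-false u≢v = refl

  remove⁻ : ∀ {u} → remove v S u ≡ true → S u ≡ true × u ≢ v
  remove⁻ {u} h with S u | u ≟ v
  ... | true | no u≢v = refl , u≢v
  remove⁻ () | true  | yes _
  remove⁻ () | false | _

insert₂ : ∀ {n} → Fin n → Fin n → VSet n → VSet n
insert₂ u v S = insert v (insert u S)

module _ {n} (u v : Fin n) (S : VSet n) where

  insert₂-there : ∀ {w} → S w ≡ true → insert₂ u v S w ≡ true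
  insert₂-there w∈S = insert-there v (insert u S) (insert-there u S w∈S)

  insert₂-fst : insert₂ u v S u ≡ true
  insert₂-fst = insert-there v (insert u S) (insert-here u S)

  insert₂-snd : insert₂ u v S v ≡ true
  insert₂-snd = insert-here v (insert u S)

  insert₂⁻ : ∀ {w} → insert₂ u v S w ≡ true → S w ≡ true ⊎ w ≡ u ⊎ w ≡ v
  insert₂⁻ h with insert⁻ v (insert u S) h
  ... | inj₂ w≡v = inj₂ (inj₂ w≡v)
  ... | inj₁ h′ with insert⁻ u S h′
  ... | inj₁ w∈S = inj₁ w∈S
  ... | inj₂ w≡u = inj₂ (inj₁ w≡u)

  insert₂-∉ : ∀ {w} → S w ≡ false → w ≢ u → w ≢ v → insert₂ u v S w ≡ false
  insert₂-∉ w∉S w≢u w≢v = insert-∉ v (insert u S) (insert-∉ u S w∉S w≢u) w≢v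

  insert₂-∉⁻ : ∀ {w} → insert₂ u v S w ≡ false → S w ≡ false × w ≢ u × w ≢ v
  insert₂-∉⁻ h with insert-∉⁻ v (insert u S) h
  ... | h′ , w≢v with insert-∉⁻ u S h′
  ... | w∉S , w≢u = w∉S , w≢u , w≢v

pair⁻ : ∀ {n} (u v : Fin n) {w} → insert₂ u v ∅ w ≡ true → w ≡ u ⊎ w ≡ v
pair⁻ u v h with insert₂⁻ u v ∅ h
... | inj₂ w≡u⊎v = w≡u⊎v

∈-∉⇒≢ : ∀ {n} {S : VSet n} {u v} → S u ≡ true → S v ≡ false → u ≢ v
∈-∉⇒≢ u∈S v∉S refl = true≢false u∈S v∉S

size : ∀ {n} → VSet n → ℕ
size {zero} S = 0
size {suc n} S = (if S zero then 1 else 0) + size (λ u → S (suc u))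

size-cong : ∀ {n} {S T : VSet n} → (∀ u → S u ≡ T u) → size S ≡ size T
size-cong {zero} S≗T = refl
size-cong {suc n} S≗T rewrite S≗T zero = cong (_ +_) (size-cong (λ u → S≗T (suc u)))

size≤ : ∀ {n} (S : VSet n) → size S ≤ n
size≤ {zero} S = z≤n
size≤ {suc n} S with S zero
... | true = s≤s (size≤ _)
... | false = ≤-trans (size≤ (λ u → S (suc u))) (n≤1+n n)

insert-suc : ∀ {n} (S : VSet (suc n)) v u → insert (suc v) S (suc u) ≡ insert v (λ u′ → S (suc u′)) u
insert-suc S v u = cong (S (suc u) ∨_) (==-suc u v)

size-insert : ∀ {n} (S : VSet n) v → S v ≡ false → size (insert v S) ≡ suc (size S)
size-insert {suc n} S zero v∉S rewrite v∉S =
  cong suc (size-cong (λ u → ∨-identityʳ (S (suc u))))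
size-insert {suc n} S (suc v) v∉S
  with S zero | trans (size-cong (insert-suc S v)) (size-insert (λ u → S (suc u)) v v∉S)
... | true  | tail = cong suc tail
... | false | tail = tail

size-insert₂ : ∀ {n} (S : VSet n) u v → S u ≡ false → S v ≡ false → u ≢ v →
                size (insert₂ u v S) ≡ suc (suc (size S))
size-insert₂ S u v u∉S v∉S u≢v =
  trans (size-insert (insert u S) v (insert-∉ u S v∉S (λ v≡u → u≢v (sym v≡u))))
        (cong suc (size-insert S u u∉S))

size< : ∀ {n} (S : VSet n) v → S v ≡ false → suc (size S) ≤ n
size< S v v∉S = subst (_≤ _) (size-insert S v v∉S) (size≤ (insert v S))


rewire : ∀ {n} (p : Fin n → Fin n) (s t : Fin n) → Fin n → Fin n
rewire p s t v = if v == s then t else (if v == t then s else p v)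

rewireE : ∀ {n m} (q : Fin n → Fin m) (s t : Fin n) (g : Fin m) → Fin n → Fin m
rewireE q s t g v = if v == s then g else (if v == t then g else q v)

module _ {n : ℕ} (p : Fin n → Fin n) (s t : Fin n) where

  rewire-s : rewire p s t s ≡ t
  rewire-s rewrite ==-refl s = refl

  rewire-t : s ≢ t → rewire p s t t ≡ s
  rewire-t s≢t rewrite ≢⇒==-false (λ t≡s → s≢t (sym t≡s)) | ==-refl t = refl

  rewire-other : ∀ {v} → v ≢ s → v ≢ t → rewire p s t v ≡ p v
  rewire-other v≢s v≢t rewrite ≢⇒==-false v≢s | ≢⇒==-false v≢t = refl

module _ {n m : ℕ} (q : Fin n → Fin m) (s t : Fin n) (g : Fin m) where

  rewireE-s : rewireE q s t g s ≡ g
  rewireE-s rewrite ==-refl s = refl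

  rewireE-t : s ≢ t → rewireE q s t g t ≡ g
  rewireE-t s≢t rewrite ≢⇒==-false (λ t≡s → s≢t (sym t≡s)) | ==-refl t = refl

  rewireE-other : ∀ {v} → v ≢ s → v ≢ t → rewireE q s t g v ≡ q v
  rewireE-other v≢s v≢t rewrite ≢⇒==-false v≢s | ≢⇒==-false v≢t = refl

rewireE-cases : ∀ {n m} (q : Fin n → Fin m) s t g v →
                rewireE q s t g v ≡ g ⊎ (v ≢ s × v ≢ t × rewireE q s t g v ≡ q v)
rewireE-cases q s t g v with ≡⊎≢ v s | ≡⊎≢ v t
... | inj₁ refl | _ = inj₁ (rewireE-s q v t g)
... | inj₂ v≢s | inj₁ refl = inj₁ (rewireE-t q s v g (λ s≡v → v≢s (sym s≡v)))
... | inj₂ v≢s | inj₂ v≢t = inj₂ (v≢s , v≢t , rewireE-other q s t g v≢s v≢t)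

-- Edges and perfect matchings

module Edges {n m : ℕ} (G : Graph n m) where

  opposite : Fin m → Fin n → Fin n
  opposite e v = if proj₁ (ends G e) == v then proj₂ (ends G e) else proj₁ (ends G e)

  Joins-sym : ∀ {e u w} → Joins G e u w → Joins G e w u
  Joins-sym (inj₁ (p , q)) = inj₂ (p , q)
  Joins-sym (inj₂ (p , q)) = inj₁ (p , q)

  Joins⇒≢ : ∀ {e u w} → Joins G e u w → u ≢ w
  Joins⇒≢ {e} (inj₁ (p , q)) u≡w = loopless G e (trans p (trans u≡w (sym q)))
  Joins⇒≢ {e} (inj₂ (p , q)) u≡w = loopless G e (trans p (trans (sym u≡w) (sym q)))

  Joins⇒Incidentˡ : ∀ {e u w} → Joins G e u w → Incident G e u
  Joins⇒Incidentˡ (inj₁ (p , q)) = inj₁ p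
  Joins⇒Incidentˡ (inj₂ (p , q)) = inj₂ q

  Joins⇒Incidentʳ : ∀ {e u w} → Joins G e u w → Incident G e w
  Joins⇒Incidentʳ (inj₁ (p , q)) = inj₂ q
  Joins⇒Incidentʳ (inj₂ (p , q)) = inj₁ p

  Joins⇒opposite : ∀ {e u w} → Joins G e u w → opposite e u ≡ w
  Joins⇒opposite {e} {u} (inj₁ (p , q)) rewrite p | ==-refl u = q
  Joins⇒opposite {e} {u} J@(inj₂ (p , q))
    rewrite p | ≢⇒==-false (λ w≡u → Joins⇒≢ J (sym w≡u)) = refl

  Incident⇒Joins : ∀ {e v} → Incident G e v → Joins G e v (opposite e v)
  Incident⇒Joins {e} {v} (inj₁ p) = subst (Joins G e v) (sym (Joins⇒opposite J)) J
    where J : Joins G e v (proj₂ (ends G e))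
          J = inj₁ (p , refl)
  Incident⇒Joins {e} {v} (inj₂ p) = subst (Joins G e v) (sym (Joins⇒opposite J)) J
    where J : Joins G e v (proj₁ (ends G e))
          J = inj₂ (refl , p)

  Joins-Incident : ∀ {e u w v} → Joins G e u w → Incident G e v → v ≡ u ⊎ v ≡ w
  Joins-Incident (inj₁ (p , q)) (inj₁ r) = inj₁ (trans (sym r) p)
  Joins-Incident (inj₁ (p , q)) (inj₂ r) = inj₂ (trans (sym r) q)
  Joins-Incident (inj₂ (p , q)) (inj₁ r) = inj₂ (trans (sym r) p)
  Joins-Incident (inj₂ (p , q)) (inj₂ r) = inj₁ (trans (sym r) q)

  Joins-functional : ∀ {e u w w′} → Joins G e u w → Joins G e u w′ → w ≡ w′
  Joins-functional J J′ = trans (sym (Joins⇒opposite J)) (Joins⇒opposite J′)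

  Joins-endpoints : ∀ {e u w u′ w′} → Joins G e u w → Joins G e u′ w′ →
                    (u′ ≡ u × w′ ≡ w) ⊎ (u′ ≡ w × w′ ≡ u)
  Joins-endpoints J J′ with Joins-Incident J (Joins⇒Incidentˡ J′)
  ... | inj₁ refl = inj₁ (refl , Joins-functional J′ J)
  ... | inj₂ refl = inj₂ (refl , Joins-functional J′ (Joins-sym J))

  Joins-distinct : ∀ {g e u w w′} → Joins G g u w → Joins G e u w′ → w ≢ w′ → g ≢ e
  Joins-distinct g-joins e-joins w≢w′ refl = w≢w′ (Joins-functional g-joins e-joins)

  -- (p , q) pairs up the vertices of S outside X: v is matched to p v by the edge q v.
  Pairing : (S X : VSet n) (p : Fin n → Fin n) (q : Fin n → Fin m) → Set
  Pairing S X p q = ∀ v → S v ≡ true → X v ≡ false →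
    S (p v) ≡ true × X (p v) ≡ false × p (p v) ≡ v × q (p v) ≡ q v × Joins G (q v) v (p v)

  rewire-pairing : ∀ {S X p q s t g} →
    Pairing S (insert₂ s t X) p q → S s ≡ true → S t ≡ true → X s ≡ false → X t ≡ false →
    Joins G g s t → Pairing S X (rewire p s t) (rewireE q s t g)
  rewire-pairing {S} {X} {p} {q} {s} {t} {g} pairs s∈S t∈S s∉X t∉X J v v∈S v∉X with ≡⊎≢ v s | ≡⊎≢ v t
  ... | inj₁ refl | _
    rewrite rewire-s p v t | rewire-t p v t (Joins⇒≢ J) | rewireE-s q v t g | rewireE-t q v t g (Joins⇒≢ J)
    = t∈S , t∉X , refl , refl , J
  ... | inj₂ v≢s | inj₁ refl
    rewrite rewire-t p s v (Joins⇒≢ J) | rewire-s p s v | rewireE-t q s v g (Joins⇒≢ J) | rewireE-s q s v g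
    = s∈S , s∉X , refl , refl , Joins-sym J
  ... | inj₂ v≢s | inj₂ v≢t with pairs v v∈S (insert₂-∉ s t X v∉X v≢s v≢t)
  ... | pv∈S , pv∉X′ , ppv , qpv , Jv with insert₂-∉⁻ s t X pv∉X′
  ... | pv∉X , pv≢s , pv≢t =
    subst (λ z → S z ≡ true) (sym r) pv∈S ,
    subst (λ z → X z ≡ false) (sym r) pv∉X ,
    trans (cong (rewire p s t) r) (trans (rewire-other p s t pv≢s pv≢t) ppv) ,
    trans (cong (rewireE q s t g) r) (trans (rewireE-other q s t g pv≢s pv≢t) (trans qpv (sym e))) ,
    subst₂ (λ x y → Joins G x v y) (sym e) (sym r) Jv
    where
      r : rewire p s t v ≡ p v
      r = rewire-other p s t v≢s v≢t
      e : rewireE q s t g v ≡ q v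
      e = rewireE-other q s t g v≢s v≢t

module PerfectMatching {n m : ℕ} (G : Graph n m) (M : Fin m → Bool) (isM : IsPerfectMatching G M) where
  open Edges G

  edgeAt : Fin n → Fin m
  edgeAt v = proj₁ (proj₁ (isM v))

  edgeAt-∈ : ∀ v → M (edgeAt v) ≡ true
  edgeAt-∈ v = proj₁ (proj₂ (proj₁ (isM v)))

  edgeAt-incident : ∀ v → Incident G (edgeAt v) v
  edgeAt-incident v = proj₂ (proj₂ (proj₁ (isM v)))

  unique : ∀ {e e′ v} → M e ≡ true → M e′ ≡ true → Incident G e v → Incident G e′ v → e ≡ e′
  unique {v = v} = proj₂ (isM v) _ _

  ∈⇒edgeAt : ∀ {e v} → M e ≡ true → Incident G e v → e ≡ edgeAt v
  ∈⇒edgeAt {v = v} e∈M inc = unique e∈M (edgeAt-∈ v) inc (edgeAt-incident v)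

  mate : Fin n → Fin n
  mate v = opposite (edgeAt v) v

  mate-joins : ∀ v → Joins G (edgeAt v) v (mate v)
  mate-joins v = Incident⇒Joins (edgeAt-incident v)

  edgeAt-mate : ∀ v → edgeAt (mate v) ≡ edgeAt v
  edgeAt-mate v = sym (∈⇒edgeAt (edgeAt-∈ v) (Joins⇒Incidentʳ (mate-joins v)))

  mate-involutive : ∀ v → mate (mate v) ≡ v
  mate-involutive v rewrite edgeAt-mate v = Joins⇒opposite (Joins-sym (mate-joins v))

  mate-sym : ∀ {u v} → mate u ≡ v → mate v ≡ u
  mate-sym {u} refl = mate-involutive u

  mate-pairing : ∀ {S X} → (∀ v → S v ≡ true → X v ≡ false → S (mate v) ≡ true × X (mate v) ≡ false) →
                 Pairing S X mate edgeAt
  mate-pairing closed v v∈S v∉X =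
    proj₁ (closed v v∈S v∉X) , proj₂ (closed v v∈S v∉X) , mate-involutive v , edgeAt-mate v , mate-joins v

  mate-≢ : ∀ v → mate v ≢ v
  mate-≢ v eq = Joins⇒≢ (mate-joins v) (sym eq)

  ∈⇒mate : ∀ {e u w} → M e ≡ true → Joins G e u w → mate u ≡ w
  ∈⇒mate e∈M J rewrite sym (∈⇒edgeAt e∈M (Joins⇒Incidentˡ J)) = Joins⇒opposite J


module Glue {n m : ℕ} (G : Graph n m) (A : Fin m → Bool) (isA : IsPerfectMatching G A)
            (S : VSet n) (p : Fin n → Fin n) (q : Fin n → Fin m)
            (closed : ∀ v → S v ≡ true → S (PerfectMatching.mate G A isA v) ≡ true)
            (pairing : Edges.Pairing G S ∅ p q) where
  open Edges G
  open PerfectMatching G A isA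

  touches : Fin m → Bool
  touches e = S (proj₁ (ends G e)) ∨ S (proj₂ (ends G e))

  used? : (e : Fin m) → Dec (∃ λ v → S v ≡ true × q v ≡ e)
  used? e = any? (λ v → (S v ≟ᵇ true) ×-dec (q v ≟ e))

  used : Fin m → Bool
  used e = ⌊ used? e ⌋

  -- The pairing (p , q) on S, the perfect matching A off S.
  glued : Fin m → Bool
  glued e = if touches e then used e else A e

  touches-intro : ∀ {e v} → Incident G e v → S v ≡ true → touches e ≡ true
  touches-intro (inj₁ refl) v∈S = ∨-trueˡ v∈S
  touches-intro {e} (inj₂ refl) v∈S = ∨-trueʳ (S (proj₁ (ends G e))) v∈S

  touches-elim : ∀ e → touches e ≡ true → ∃ λ v → Incident G e v × S v ≡ true
  touches-elim e h with ∨-true⁻ (S (proj₁ (ends G e))) h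
  ... | inj₁ x = _ , inj₁ refl , x
  ... | inj₂ x = _ , inj₂ refl , x

  touches-false : ∀ {e u w} → Joins G e u w → S u ≡ false → S w ≡ false → touches e ≡ false
  touches-false (inj₁ (refl , refl)) u∉S w∉S = cong₂ _∨_ u∉S w∉S
  touches-false (inj₂ (refl , refl)) u∉S w∉S = cong₂ _∨_ w∉S u∉S

  used-intro : ∀ v → S v ≡ true → used (q v) ≡ true
  used-intro v v∈S with used? (q v)
  ... | yes _ = refl
  ... | no ¬used = ⊥-elim (¬used (v , v∈S , refl))

  used-elim : ∀ e → used e ≡ true → ∃ λ v → S v ≡ true × q v ≡ e
  used-elim e h with used? e
  ... | yes x = x

  glued-touching : ∀ e → touches e ≡ true → glued e ≡ used e
  glued-touching e h rewrite h = refl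

  glued-outside : ∀ e → touches e ≡ false → glued e ≡ A e
  glued-outside e h rewrite h = refl

  private
    glued-inside : ∀ {e v} → glued e ≡ true → Incident G e v → S v ≡ true → e ≡ q v
    glued-inside {e} {v} h inc v∈S
      with used-elim e (trans (sym (glued-touching e (touches-intro inc v∈S))) h)
    ... | u , u∈S , refl with pairing u u∈S refl
    ... | _ , _ , _ , q-sym , J with Joins-Incident J inc
    ... | inj₁ refl = refl
    ... | inj₂ refl = sym q-sym

    glued-leaving : ∀ {e v} → glued e ≡ true → Incident G e v → S v ≡ false → touches e ≡ false
    glued-leaving {e} {v} h inc v∉S with touches e in t
    ... | false = refl
    ... | true with used-elim e h
    ... | u , u∈S , refl with pairing u u∈S refl
    ... | pu∈S , _ , _ , _ , J with Joins-Incident J inc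
    ... | inj₁ refl = ⊥-elim (true≢false u∈S v∉S)
    ... | inj₂ refl = ⊥-elim (true≢false pu∈S v∉S)

  pairing-edge-joins : ∀ v → S v ≡ true → Joins G (q v) v (p v)
  pairing-edge-joins v v∈S = proj₂ (proj₂ (proj₂ (proj₂ (pairing v v∈S refl))))

  glued-pairing-edge : ∀ v → S v ≡ true → glued (q v) ≡ true
  glued-pairing-edge v v∈S =
    trans (glued-touching (q v) (touches-intro (Joins⇒Incidentˡ (pairing-edge-joins v v∈S)) v∈S))
          (used-intro v v∈S)

  glued-keeps : ∀ {e} → A e ≡ true → (∀ {u} → Incident G e u → S u ≡ false) → glued e ≡ true
  glued-keeps {e} e∈A outside =
    trans (glued-outside e (cong₂ _∨_ (outside (inj₁ refl)) (outside (inj₂ refl)))) e∈A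

  glued-avoids : ∀ {e u} → Incident G e u → S u ≡ true → (∀ v → S v ≡ true → q v ≢ e) → glued e ≡ false
  glued-avoids {e} inc u∈S unused = trans (glued-touching e (touches-intro inc u∈S))
    (¬-not λ e-used → let (v , v∈S , qv≡e) = used-elim e e-used in unused v v∈S qv≡e)

  glued-isPerfectMatching : IsPerfectMatching G glued
  glued-isPerfectMatching v with S v in v∈S
  ... | true = (q v , glued-pairing-edge v v∈S , Joins⇒Incidentˡ (pairing-edge-joins v v∈S))
             , λ e e′ h h′ i i′ → trans (glued-inside h i v∈S) (sym (glued-inside h′ i′ v∈S))
  ... | false = (edgeAt v , trans (glued-outside (edgeAt v) edge-outside) (edgeAt-∈ v) , edgeAt-incident v)
              , λ e e′ h h′ i i′ → unique (trans (sym (glued-outside e (glued-leaving h i v∈S))) h)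
                                          (trans (sym (glued-outside e′ (glued-leaving h′ i′ v∈S))) h′) i i′
    where
      mate∉S : S (mate v) ≡ false
      mate∉S = ¬-not λ m∈S →
        true≢false (subst (λ z → S z ≡ true) (mate-involutive v) (closed (mate v) m∈S)) v∈S
      edge-outside : touches (edgeAt v) ≡ false
      edge-outside = touches-false (mate-joins v) v∈S mate∉S

exchange-parallel : ∀ {n m} {G : Graph n m} {Q} (isQ : IsPerfectMatching G Q) {x g} →
  Joins G g x (PerfectMatching.mate G Q isQ x) →
  Σ (Fin m → Bool) λ Q′ → IsPerfectMatching G Q′ × Q′ g ≡ true ×
    (∀ h → ¬ Incident G h x → ¬ Incident G h (PerfectMatching.mate G Q isQ x) → Q′ h ≡ Q h)
exchange-parallel {n} {G = G} {Q} isQ {x} {g} g-joins =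
  glued , glued-isPerfectMatching ,
  subst (λ e → glued e ≡ true) (rewireE-s edgeAt x y g) (glued-pairing-edge x x∈S) ,
  λ h h∤x h∤y → glued-outside h (¬-not λ touching →
    let (v , h-inc , v∈S) = touches-elim h touching in
    [ (λ v≡x → h∤x (subst (Incident G h) v≡x h-inc)) , (λ v≡y → h∤y (subst (Incident G h) v≡y h-inc)) ]
      (pair⁻ x y {v} v∈S))
  where
    open PerfectMatching G Q isQ
    y : Fin n
    y = mate x
    S : VSet n
    S = insert₂ x y ∅
    x∈S : S x ≡ true
    x∈S = insert₂-fst x y ∅
    M-closed-S : ∀ v → S v ≡ true → S (mate v) ≡ true
    M-closed-S v v∈S with pair⁻ x y {v} v∈S
    ... | inj₁ refl = insert₂-snd x y ∅
    ... | inj₂ refl = subst (λ z → S z ≡ true) (sym (mate-involutive x)) x∈S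
    -- vacuous: rewiring re-pairs both vertices of S
    empty : Edges.Pairing G S S mate edgeAt
    empty v v∈S v∉S = ⊥-elim (true≢false v∈S v∉S)
    open Glue G Q isQ S (rewire mate x y) (rewireE edgeAt x y g) M-closed-S
              (Edges.rewire-pairing G empty x∈S (insert₂-snd x y ∅) refl refl g-joins)

-- The alternating walk

PMThroughAvoiding : ∀ {n m} → Graph n m → Fin m → Fin m → Set
PMThroughAvoiding {m = m} G f e = Σ (Fin m → Bool) λ R → IsPerfectMatching G R × R f ≡ true × R e ≡ false

module AlternatingWalk {n m : ℕ} (G : Graph n m)
  (N : Fin m → Bool) (isN : IsPerfectMatching G N)
  (M : Fin m → Bool) (isM : IsPerfectMatching G M)
  {i j a b : Fin n} {e₀ f : Fin m}
  (e₀∈N : N e₀ ≡ true) (e₀-joins : Joins G e₀ i j) (f∈N : N f ≡ true) (f≢e₀ : f ≢ e₀)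
  (e₀∉M : M e₀ ≡ false) (mate-a : PerfectMatching.mate G M isM a ≡ b)
  {ia ib ja jb : Fin m}
  (ia-joins : Joins G ia i a) (ib-joins : Joins G ib i b)
  (ja-joins : Joins G ja j a) (jb-joins : Joins G jb j b)
  where
  open Edges G
  module 𝑁 = PerfectMatching G N isN
  module 𝑀 = PerfectMatching G M isM

  i≢j : i ≢ j
  i≢j = Joins⇒≢ e₀-joins

  i≢a : i ≢ a
  i≢a = Joins⇒≢ ia-joins

  i≢b : i ≢ b
  i≢b = Joins⇒≢ ib-joins

  j≢a : j ≢ a
  j≢a = Joins⇒≢ ja-joins

  j≢b : j ≢ b
  j≢b = Joins⇒≢ jb-joins

  a≢b : a ≢ b
  a≢b a≡b = 𝑀.mate-≢ a (trans mate-a (sym a≡b))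

  mate-b : 𝑀.mate b ≡ a
  mate-b = 𝑀.mate-sym mate-a

  N-mate-i : 𝑁.mate i ≡ j
  N-mate-i = 𝑁.∈⇒mate e₀∈N e₀-joins

  N-mate-j : 𝑁.mate j ≡ i
  N-mate-j = 𝑁.∈⇒mate e₀∈N (Joins-sym e₀-joins)

  N-mate≢i : ∀ {v} → v ≢ j → 𝑁.mate v ≢ i
  N-mate≢i v≢j m≡i = v≢j (trans (sym (𝑁.mate-sym m≡i)) N-mate-i)

  N-mate≢j : ∀ {v} → v ≢ i → 𝑁.mate v ≢ j
  N-mate≢j v≢i m≡j = v≢i (trans (sym (𝑁.mate-sym m≡j)) N-mate-j)

  N-edgeAt≢e₀ : ∀ {u} → u ≢ i → u ≢ j → 𝑁.edgeAt u ≢ e₀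
  N-edgeAt≢e₀ {u} u≢i u≢j eq
    with Joins-Incident e₀-joins (subst (λ z → Incident G z u) eq (𝑁.edgeAt-incident u))
  ... | inj₁ u≡i = u≢i u≡i
  ... | inj₂ u≡j = u≢j u≡j

  M-edgeAt≢e₀ : ∀ u → 𝑀.edgeAt u ≢ e₀
  M-edgeAt≢e₀ u eq = true≢false (trans (cong M (sym eq)) (𝑀.edgeAt-∈ u)) e₀∉M

  chord-i≢e₀ : ∀ {g w} → Joins G g w i → w ≢ j → g ≢ e₀
  chord-i≢e₀ g-joins w≢j = Joins-distinct (Joins-sym g-joins) e₀-joins w≢j

  chord-j≢e₀ : ∀ {g w} → Joins G g j w → w ≢ i → g ≢ e₀
  chord-j≢e₀ g-joins w≢i = Joins-distinct g-joins (Joins-sym e₀-joins) w≢i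

  f-outside : (S : VSet n) → (∀ v → S v ≡ true → 𝑁.edgeAt v ≢ f) → ∀ {u} → Incident G f u → S u ≡ false
  f-outside S fresh {u} inc = ¬-not λ u∈S → fresh u u∈S (sym (𝑁.∈⇒edgeAt f∈N inc))

  -- The visited vertices of the alternating path i -N- j -M- · -N- · … -M- · -N- end;
  -- the path closes into an alternating cycle once the M-mate of end is i.
  record Walk : Set where
    field
      visited  : VSet n
      end      : Fin n
      i∈       : visited i ≡ true
      j∈       : visited j ≡ true
      end∈     : visited end ≡ true
      end≢i    : end ≢ i
      N-closed : ∀ v → visited v ≡ true → visited (𝑁.mate v) ≡ true
      M-closed : ∀ v → visited v ≡ true → v ≢ end → v ≢ i →
                 visited (𝑀.mate v) ≡ true × 𝑀.mate v ≢ end × 𝑀.mate v ≢ i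
  open Walk

  Fresh : Walk → Set
  Fresh w = ∀ v → visited w v ≡ true → 𝑁.edgeAt v ≢ f

  Met : Walk → Set
  Met w = ∃ λ y → visited w y ≡ true × y ≢ i × y ≢ j × 𝑁.edgeAt y ≡ f

  M-closed-cycle : (w : Walk) → 𝑀.mate (end w) ≡ i → ∀ v → visited w v ≡ true → visited w (𝑀.mate v) ≡ true
  M-closed-cycle w closed v v∈ with ≡⊎≢ v (end w) | ≡⊎≢ v i
  ... | inj₁ refl | _ = subst (λ z → visited w z ≡ true) (sym closed) (i∈ w)
  ... | inj₂ _ | inj₁ refl =
    subst (λ z → visited w z ≡ true) (sym (𝑀.mate-sym closed)) (end∈ w)
  ... | inj₂ v≢end | inj₂ v≢i = proj₁ (M-closed w v v∈ v≢end v≢i)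

  -- The walk has closed into an alternating cycle avoiding f: use M on it.
  close-fresh : (w : Walk) → 𝑀.mate (end w) ≡ i → Fresh w → PMThroughAvoiding G f e₀
  close-fresh w closed fresh =
    glued , glued-isPerfectMatching , glued-keeps f∈N (f-outside (visited w) fresh) ,
    glued-avoids (Joins⇒Incidentˡ e₀-joins) (i∈ w) (λ u _ → M-edgeAt≢e₀ u)
    where
      open Glue G N isN (visited w) 𝑀.mate 𝑀.edgeAt (N-closed w)
                (𝑀.mate-pairing λ v v∈ _ → M-closed-cycle w closed v v∈ , refl)

  -- The path from i ends at a vertex adjacent to i by the chord g: closing it with g gives
  -- an alternating cycle avoiding f; switch it to M.
  reach-fresh : (w : Walk) → Fresh w → ∀ {g} → Joins G g (end w) i → end w ≢ j → PMThroughAvoiding G f e₀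
  reach-fresh w fresh {g} g-joins end≢j =
    glued , glued-isPerfectMatching , glued-keeps f∈N (f-outside (visited w) fresh) ,
    glued-avoids (Joins⇒Incidentˡ e₀-joins) (i∈ w) (λ u _ → avoids u)
    where
      closed : ∀ v → visited w v ≡ true → insert₂ (end w) i ∅ v ≡ false →
               visited w (𝑀.mate v) ≡ true × insert₂ (end w) i ∅ (𝑀.mate v) ≡ false
      closed v v∈ v∉ with insert₂-∉⁻ (end w) i ∅ v∉
      ... | _ , v≢end , v≢i with M-closed w v v∈ v≢end v≢i
      ... | m∈ , m≢end , m≢i = m∈ , insert₂-∉ (end w) i ∅ refl m≢end m≢i
      open Glue G N isN (visited w) (rewire 𝑀.mate (end w) i) (rewireE 𝑀.edgeAt (end w) i g) (N-closed w)
                (rewire-pairing (𝑀.mate-pairing closed) (end∈ w) (i∈ w) refl refl g-joins)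
      avoids : ∀ u → rewireE 𝑀.edgeAt (end w) i g u ≢ e₀
      avoids u eq with rewireE-cases 𝑀.edgeAt (end w) i g u
      ... | inj₁ is-g = chord-i≢e₀ g-joins end≢j (trans (sym is-g) eq)
      ... | inj₂ (_ , _ , is-M) = M-edgeAt≢e₀ u (trans (sym is-M) eq)

  -- f lies on the path, which has reached one of a, b and continues by the M-edge to the
  -- other one c: drop i and use the N-edges of the path, with the chord g joining j to c.
  module WithoutI (w : Walk) {c} (mate-end : 𝑀.mate (end w) ≡ c) (c∉ : visited w c ≡ false) where
    S : VSet n
    S = insert c (remove i (visited w))

    inS : ∀ {u} → visited w u ≡ true → u ≢ i → S u ≡ true
    inS u∈ u≢i = insert-there c (remove i (visited w)) (remove⁺ i (visited w) u∈ u≢i)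

    S-c : S c ≡ true
    S-c = insert-here c (remove i (visited w))

    S-j : S j ≡ true
    S-j = inS (j∈ w) (≢-sym i≢j)

    S⁻ : ∀ {u} → S u ≡ true → (visited w u ≡ true × u ≢ i) ⊎ u ≡ c
    S⁻ h with insert⁻ c (remove i (visited w)) h
    ... | inj₁ h′ = inj₁ (remove⁻ i (visited w) h′)
    ... | inj₂ u≡c = inj₂ u≡c

    M-closed-S : ∀ v → S v ≡ true → S (𝑀.mate v) ≡ true
    M-closed-S v v∈ with S⁻ v∈
    ... | inj₂ refl = subst (λ z → S z ≡ true) (sym (𝑀.mate-sym mate-end)) (inS (end∈ w) (end≢i w))
    ... | inj₁ (v∈w , v≢i) with ≡⊎≢ v (end w)
    ... | inj₁ refl = subst (λ z → S z ≡ true) (sym mate-end) S-c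
    ... | inj₂ v≢end with M-closed w v v∈w v≢end v≢i
    ... | m∈ , _ , m≢i = inS m∈ m≢i

    N-closed-S : ∀ v → S v ≡ true → insert₂ j c ∅ v ≡ false →
                 S (𝑁.mate v) ≡ true × insert₂ j c ∅ (𝑁.mate v) ≡ false
    N-closed-S v v∈ v∉ with insert₂-∉⁻ j c ∅ v∉ | S⁻ v∈
    ... | _ , _ , v≢c | inj₂ v≡c = ⊥-elim (v≢c v≡c)
    ... | _ , v≢j , _ | inj₁ (v∈w , v≢i) =
      inS m∈ (N-mate≢i v≢j) , insert₂-∉ j c ∅ refl (N-mate≢j v≢i) (∈-∉⇒≢ m∈ c∉)
      where
        m∈ : visited w (𝑁.mate v) ≡ true
        m∈ = N-closed w v v∈w

  reach-met : (w : Walk) → Met w → ∀ {c} → 𝑀.mate (end w) ≡ c → visited w c ≡ false →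
              ∀ {g} → Joins G g j c → c ≢ i → PMThroughAvoiding G f e₀
  reach-met w (y , y∈ , y≢i , y≢j , y-edge) {c} mate-end c∉ {g} g-joins c≢i =
    glued , glued-isPerfectMatching ,
    subst (λ e → glued e ≡ true) y-rewired (glued-pairing-edge y (inS y∈ y≢i)) ,
    glued-avoids (Joins⇒Incidentʳ e₀-joins) S-j avoids
    where
      open WithoutI w mate-end c∉
      open Glue G M isM S (rewire 𝑁.mate j c) (rewireE 𝑁.edgeAt j c g) M-closed-S
                (rewire-pairing (𝑁.mate-pairing N-closed-S) S-j S-c refl refl g-joins)
      y-rewired : rewireE 𝑁.edgeAt j c g y ≡ f
      y-rewired = trans (rewireE-other 𝑁.edgeAt j c g y≢j (∈-∉⇒≢ y∈ c∉)) y-edge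
      avoids : ∀ u → S u ≡ true → rewireE 𝑁.edgeAt j c g u ≢ e₀
      avoids u u∈ eq with rewireE-cases 𝑁.edgeAt j c g u
      ... | inj₁ is-g = chord-j≢e₀ g-joins c≢i (trans (sym is-g) eq)
      ... | inj₂ (u≢j , u≢c , is-N) with S⁻ u∈
      ... | inj₂ u≡c = u≢c u≡c
      ... | inj₁ (_ , u≢i) = N-edgeAt≢e₀ u≢i u≢j (trans (sym is-N) eq)

  -- f lies on the alternating cycle C, and the M-edge ab is disjoint from C: on C ∪ {a, b}
  -- use the N-edges of C with ij replaced by the chords ia and jb.
  module WithAB (w : Walk) (closed : 𝑀.mate (end w) ≡ i) (a∉ : visited w a ≡ false) (b∉ : visited w b ≡ false)
    where
    S : VSet n
    S = insert₂ a b (visited w)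

    inS : ∀ {u} → visited w u ≡ true → S u ≡ true
    inS = insert₂-there a b (visited w)

    M-closed-S : ∀ v → S v ≡ true → S (𝑀.mate v) ≡ true
    M-closed-S v v∈ with insert₂⁻ a b (visited w) v∈
    ... | inj₁ v∈w = inS (M-closed-cycle w closed v v∈w)
    ... | inj₂ (inj₁ refl) = subst (λ z → S z ≡ true) (sym mate-a) (insert₂-snd a b (visited w))
    ... | inj₂ (inj₂ refl) = subst (λ z → S z ≡ true) (sym mate-b) (insert₂-fst a b (visited w))

    X : VSet n
    X = insert₂ j b ∅

    N-closed-S : ∀ v → S v ≡ true → insert₂ i a X v ≡ false →
                 S (𝑁.mate v) ≡ true × insert₂ i a X (𝑁.mate v) ≡ false
    N-closed-S v v∈ v∉ with insert₂-∉⁻ i a X v∉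
    ... | v∉X , v≢i , v≢a with insert₂-∉⁻ j b ∅ v∉X | insert₂⁻ a b (visited w) v∈
    ... | _ , _ , v≢b | inj₂ (inj₂ v≡b) = ⊥-elim (v≢b v≡b)
    ... | _ , _ , _ | inj₂ (inj₁ v≡a) = ⊥-elim (v≢a v≡a)
    ... | _ , v≢j , _ | inj₁ v∈w =
      inS m∈ ,
      insert₂-∉ i a X (insert₂-∉ j b ∅ refl (N-mate≢j v≢i) (∈-∉⇒≢ {S = visited w} m∈ b∉))
                      (N-mate≢i v≢j) (∈-∉⇒≢ {S = visited w} m∈ a∉)
      where
        m∈ : visited w (𝑁.mate v) ≡ true
        m∈ = N-closed w v v∈w

    inner : Pairing S X (rewire 𝑁.mate i a) (rewireE 𝑁.edgeAt i a ia)
    inner = rewire-pairing (𝑁.mate-pairing N-closed-S) (inS (i∈ w)) (insert₂-fst a b (visited w))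
              (insert₂-∉ j b ∅ refl i≢j i≢b)
              (insert₂-∉ j b ∅ refl (≢-sym j≢a) a≢b) ia-joins

  close-met : (w : Walk) → 𝑀.mate (end w) ≡ i → Met w → visited w a ≡ false → visited w b ≡ false →
              PMThroughAvoiding G f e₀
  close-met w closed (y , y∈ , y≢i , y≢j , y-edge) a∉ b∉ =
    glued , glued-isPerfectMatching ,
    subst (λ e → glued e ≡ true) y-rewired (glued-pairing-edge y (insert₂-there a b (visited w) y∈)) ,
    glued-avoids (Joins⇒Incidentˡ e₀-joins) (inS (i∈ w)) avoids
    where
      open WithAB w closed a∉ b∉
      p : Fin n → Fin n
      p = rewire (rewire 𝑁.mate i a) j b
      q : Fin n → Fin m
      q = rewireE (rewireE 𝑁.edgeAt i a ia) j b jb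
      open Glue G M isM S p q M-closed-S
                (rewire-pairing inner (inS (j∈ w)) (insert₂-snd a b (visited w)) refl refl jb-joins)
      y-rewired : q y ≡ f
      y-rewired = trans (rewireE-other (rewireE 𝑁.edgeAt i a ia) j b jb y≢j (∈-∉⇒≢ {S = visited w} y∈ b∉))
                        (trans (rewireE-other 𝑁.edgeAt i a ia y≢i (∈-∉⇒≢ {S = visited w} y∈ a∉)) y-edge)
      avoids : ∀ u → S u ≡ true → q u ≢ e₀
      avoids u _ eq with rewireE-cases (rewireE 𝑁.edgeAt i a ia) j b jb u
      ... | inj₁ is-jb = chord-j≢e₀ jb-joins (≢-sym i≢b) (trans (sym is-jb) eq)
      ... | inj₂ (u≢j , _ , is-inner) with rewireE-cases 𝑁.edgeAt i a ia u
      ... | inj₁ is-ia =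
        chord-i≢e₀ (Joins-sym ia-joins) (≢-sym j≢a) (trans (sym (trans is-inner is-ia)) eq)
      ... | inj₂ (u≢i , _ , is-N) = N-edgeAt≢e₀ u≢i u≢j (trans (sym (trans is-inner is-N)) eq)

  module Extend (w : Walk) (unclosed : 𝑀.mate (end w) ≢ i) where
    y x : Fin n
    y = 𝑀.mate (end w)
    x = 𝑁.mate y

    y∉ : visited w y ≡ false
    y∉ = ¬-not λ y∈ → proj₁ (proj₂ (M-closed w y y∈ (𝑀.mate-≢ (end w)) unclosed)) (𝑀.mate-involutive (end w))

    x∉ : visited w x ≡ false
    x∉ = ¬-not λ x∈ → true≢false (subst (λ z → visited w z ≡ true) (𝑁.mate-involutive y) (N-closed w x x∈)) y∉

    y≢x : y ≢ x
    y≢x y≡x = 𝑁.mate-≢ y (sym y≡x)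

    S : VSet n
    S = insert₂ y x (visited w)

    inS : ∀ {u} → visited w u ≡ true → S u ≡ true
    inS = insert₂-there y x (visited w)

    next : Walk
    next = record
      { visited = S ; end = x
      ; i∈ = inS (i∈ w) ; j∈ = inS (j∈ w) ; end∈ = insert₂-snd y x (visited w)
      ; end≢i = ≢-sym (∈-∉⇒≢ {S = visited w} (i∈ w) x∉)
      ; N-closed = N-closed-next ; M-closed = M-closed-next }
      where
        N-closed-next : ∀ v → S v ≡ true → S (𝑁.mate v) ≡ true
        N-closed-next v v∈ with insert₂⁻ y x (visited w) v∈
        ... | inj₁ v∈w = inS (N-closed w v v∈w)
        ... | inj₂ (inj₁ refl) = insert₂-snd y x (visited w)
        ... | inj₂ (inj₂ refl) =
          subst (λ z → S z ≡ true) (sym (𝑁.mate-involutive y)) (insert₂-fst y x (visited w))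
        M-closed-next : ∀ v → S v ≡ true → v ≢ x → v ≢ i → S (𝑀.mate v) ≡ true × 𝑀.mate v ≢ x × 𝑀.mate v ≢ i
        M-closed-next v v∈ v≢x v≢i with insert₂⁻ y x (visited w) v∈
        ... | inj₂ (inj₂ v≡x) = ⊥-elim (v≢x v≡x)
        ... | inj₂ (inj₁ refl) =
          subst (λ z → S z ≡ true) (sym (𝑀.mate-involutive (end w))) (inS (end∈ w)) ,
          subst (_≢ x) (sym (𝑀.mate-involutive (end w))) (∈-∉⇒≢ {S = visited w} (end∈ w) x∉) ,
          subst (_≢ i) (sym (𝑀.mate-involutive (end w))) (end≢i w)
        ... | inj₁ v∈w with ≡⊎≢ v (end w)
        ... | inj₁ refl = insert₂-fst y x (visited w) , y≢x , unclosed
        ... | inj₂ v≢end with M-closed w v v∈w v≢end v≢i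
        ... | m∈ , _ , m≢i = inS m∈ , ∈-∉⇒≢ {S = visited w} m∈ x∉ , m≢i

    size-next : size S ≡ suc (suc (size (visited w)))
    size-next = size-insert₂ (visited w) y x y∉ x∉ y≢x

    progress : Fresh w ⊎ Met w → Fresh next ⊎ Met next
    progress (inj₂ (z , z∈ , rest)) = inj₂ (z , inS z∈ , rest)
    progress (inj₁ fresh) with ≡⊎≢ (𝑁.edgeAt y) f
    ... | inj₁ y-edge = inj₂ (y , insert₂-fst y x (visited w) , unclosed ,
                              ≢-sym (∈-∉⇒≢ {S = visited w} (j∈ w) y∉) , y-edge)
    ... | inj₂ y-edge≢f = inj₁ fresh-next
      where
        fresh-next : Fresh next
        fresh-next v v∈ with insert₂⁻ y x (visited w) v∈
        ... | inj₁ v∈w = fresh v v∈w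
        ... | inj₂ (inj₁ refl) = y-edge≢f
        ... | inj₂ (inj₂ refl) = λ eq → y-edge≢f (trans (sym (𝑁.edgeAt-mate y)) eq)

  reach : (w : Walk) → Fresh w ⊎ Met w → ∀ {c} → 𝑀.mate (end w) ≡ c → visited w c ≡ false →
          ∀ {g g′} → Joins G g (end w) i → end w ≢ j → Joins G g′ j c → c ≢ i → PMThroughAvoiding G f e₀
  reach w (inj₁ fresh) _ _ g-joins end≢j _ _ = reach-fresh w fresh g-joins end≢j
  reach w (inj₂ met) mate-end c∉ _ _ g′-joins c≢i = reach-met w met mate-end c∉ g′-joins c≢i

  -- The fuel k bounds the number of extensions: each one visits two new vertices.
  walk : (k : ℕ) (w : Walk) → n ≤ size (visited w) + k → Fresh w ⊎ Met w →
         visited w a ≡ false → visited w b ≡ false → PMThroughAvoiding G f e₀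
  walk k w bound fm a∉ b∉ with ≡⊎≢ (𝑀.mate (end w)) i
  ... | inj₁ closed = [ close-fresh w closed , (λ met → close-met w closed met a∉ b∉) ] fm
  ... | inj₂ unclosed = step k bound
    where
      open Extend w unclosed
      end≢ : ∀ {c} → visited w c ≡ false → end w ≢ c
      end≢ c∉ = ∈-∉⇒≢ {S = visited w} (end∈ w) c∉
      y≢a : y ≢ a
      y≢a y≡a = end≢ b∉ (trans (sym (𝑀.mate-sym y≡a)) mate-a)
      y≢b : y ≢ b
      y≢b y≡b = end≢ a∉ (trans (sym (𝑀.mate-sym y≡b)) mate-b)
      step : (k : ℕ) → n ≤ size (visited w) + k → PMThroughAvoiding G f e₀
      step k bound with ≡⊎≢ x a | ≡⊎≢ x b
      ... | inj₁ x≡a | _ =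
        reach next (progress fm) (trans (cong 𝑀.mate x≡a) mate-a)
              (insert₂-∉ y x (visited w) b∉ (≢-sym y≢b) (λ b≡x → a≢b (trans (sym x≡a) (sym b≡x))))
              (subst (λ z → Joins G ia z i) (sym x≡a) (Joins-sym ia-joins))
              (λ x≡j → j≢a (trans (sym x≡j) x≡a)) jb-joins (≢-sym i≢b)
      ... | inj₂ _ | inj₁ x≡b =
        reach next (progress fm) (trans (cong 𝑀.mate x≡b) mate-b)
              (insert₂-∉ y x (visited w) a∉ (≢-sym y≢a) (λ a≡x → a≢b (trans a≡x x≡b)))
              (subst (λ z → Joins G ib z i) (sym x≡b) (Joins-sym ib-joins))
              (λ x≡j → j≢b (trans (sym x≡j) x≡b)) ja-joins (≢-sym i≢a)
      step zero bound | inj₂ _ | inj₂ _ =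
        ⊥-elim (<⇒≱ (size< (visited w) y y∉) (subst (n ≤_) (+-identityʳ (size (visited w))) bound))
      step (suc k) bound | inj₂ x≢a | inj₂ x≢b =
        walk k next bound′ (progress fm)
             (insert₂-∉ y x (visited w) a∉ (≢-sym y≢a) (≢-sym x≢a))
             (insert₂-∉ y x (visited w) b∉ (≢-sym y≢b) (≢-sym x≢b))
        where
          bound′ : n ≤ size S + k
          bound′ rewrite size-next =
            ≤-trans bound (≤-trans (≤-reflexive (+-suc (size (visited w)) k)) (n≤1+n _))

  start : PMThroughAvoiding G f e₀
  start = walk n initial (m≤n+m n _) (inj₁ fresh) (insert₂-∉ i j ∅ refl (≢-sym i≢a) (≢-sym j≢a))
                                                 (insert₂-∉ i j ∅ refl (≢-sym i≢b) (≢-sym j≢b))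
    where
      S : VSet n
      S = insert₂ i j ∅
      initial : Walk
      initial = record
        { visited = S ; end = j
        ; i∈ = insert₂-fst i j ∅ ; j∈ = insert₂-snd i j ∅ ; end∈ = insert₂-snd i j ∅ ; end≢i = ≢-sym i≢j
        ; N-closed = N-closed-S ; M-closed = λ v v∈ v≢j v≢i → ⊥-elim ([ v≢i , v≢j ] (pair⁻ i j {v} v∈)) }
        where
          N-closed-S : ∀ v → S v ≡ true → S (𝑁.mate v) ≡ true
          N-closed-S v v∈ with pair⁻ i j {v} v∈
          ... | inj₁ refl = subst (λ z → S z ≡ true) (sym N-mate-i) (insert₂-snd i j ∅)
          ... | inj₂ refl = subst (λ z → S z ≡ true) (sym N-mate-j) (insert₂-fst i j ∅)
      fresh : Fresh initial
      fresh v v∈ eq with pair⁻ i j {v} v∈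
      ... | inj₁ refl = f≢e₀ (trans (sym eq) (sym (𝑁.∈⇒edgeAt e₀∈N (Joins⇒Incidentˡ e₀-joins))))
      ... | inj₂ refl = f≢e₀ (trans (sym eq) (sym (𝑁.∈⇒edgeAt e₀∈N (Joins⇒Incidentʳ e₀-joins))))

-- Removable edges

module EdgeDeletion {n m : ℕ} (G : Graph n (suc m)) (e : Fin (suc m)) where

  punchIn-onto : ∀ {g} → g ≢ e → ∃ λ h → punchIn e h ≡ g
  punchIn-onto g≢e = punchOut (≢-sym g≢e) , punchIn-punchOut (≢-sym g≢e)

  restrict : ∀ {R} → IsPerfectMatching G R → R e ≡ false →
             IsPerfectMatching (deleteEdge G e) (λ h → R (punchIn e h))
  restrict {R} isR e∉R v with isR v
  ... | (g , g∈R , g-inc) , unique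
    with punchIn-onto {g} (λ g≡e → true≢false (trans (cong R (sym g≡e)) g∈R) e∉R)
  ... | h , refl =
    (h , g∈R , g-inc) , λ h₁ h₂ r₁ r₂ i₁ i₂ → punchIn-injective e h₁ h₂ (unique _ _ r₁ r₂ i₁ i₂)

  extend : (Fin m → Bool) → Fin (suc m) → Bool
  extend M g with ≡⊎≢ g e
  ... | inj₁ _ = false
  ... | inj₂ g≢e = M (punchOut (≢-sym g≢e))

  extend-e : ∀ M → extend M e ≡ false
  extend-e M with ≡⊎≢ e e
  ... | inj₁ _ = refl
  ... | inj₂ e≢e = ⊥-elim (e≢e refl)

  extend-punchIn : ∀ M h → extend M (punchIn e h) ≡ M h
  extend-punchIn M h with ≡⊎≢ (punchIn e h) e
  ... | inj₁ eq = ⊥-elim (punchInᵢ≢i e h eq)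
  ... | inj₂ _ = cong M (trans (punchOut-cong e refl) (punchOut-punchIn e))

  extend⁻ : ∀ M g → extend M g ≡ true → ∃ λ h → punchIn e h ≡ g × M h ≡ true
  extend⁻ M g g∈ with ≡⊎≢ g e
  extend⁻ M g () | inj₁ _
  ... | inj₂ g≢e = punchOut (≢-sym g≢e) , punchIn-punchOut (≢-sym g≢e) , g∈

  extend-isPerfectMatching : ∀ {M} → IsPerfectMatching (deleteEdge G e) M → IsPerfectMatching G (extend M)
  extend-isPerfectMatching {M} isM v with isM v
  ... | (h , h∈M , h-inc) , unique = (punchIn e h , trans (extend-punchIn M h) h∈M , h-inc) , unique′
    where
      unique′ : ∀ g g′ → extend M g ≡ true → extend M g′ ≡ true → Incident G g v → Incident G g′ v → g ≡ g′
      unique′ g g′ g∈ g′∈ i i′ with extend⁻ M g g∈ | extend⁻ M g′ g′∈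
      ... | h₁ , refl , h₁∈ | h₂ , refl , h₂∈ = cong (punchIn e) (unique h₁ h₂ h₁∈ h₂∈ i i′)

  Adj-delete : ∀ {g u w} → g ≢ e → Joins G g u w → Adj (deleteEdge G e) u w
  Adj-delete g≢e J with punchIn-onto g≢e
  ... | h , refl = h , J

  removable⇒through-avoiding : Removable G e → ∀ g → g ≢ e → PMThroughAvoiding G g e
  removable⇒through-avoiding (_ , _ , covered) g g≢e with punchIn-onto g≢e
  ... | h , refl with covered h
  ... | M , isM , h∈M = extend M , extend-isPerfectMatching isM , trans (extend-punchIn M h) h∈M , extend-e M

  through-avoiding⇒removable : MatchingCovered G → Connected (deleteEdge G e) →
                               (∀ g → g ≢ e → PMThroughAvoiding G g e) → Removable G e
  through-avoiding⇒removable (_ , 2≤n , _) connected through =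
    connected , 2≤n , λ h → let (R , isR , R-h , R-e) = through (punchIn e h) (punchInᵢ≢i e h)
                            in _ , restrict isR R-e , R-h

removable-by-chords : ∀ {n m} {G : Graph n m} → MatchingCovered G →
  ∀ {e₀ i j} → Joins G e₀ i j →
  ∀ {M} (isM : IsPerfectMatching G M) → M e₀ ≡ false →
  ∀ {a b} → PerfectMatching.mate G M isM a ≡ b →
  ∀ {ia ib ja jb} → Joins G ia i a → Joins G ib i b → Joins G ja j a → Joins G jb j b →
  Removable G e₀
removable-by-chords {m = zero} _ {e₀ = ()}
removable-by-chords {m = suc m} {G} mc@(connected , _ , covered) {e₀} {i} {j} e₀-joins {M} isM e₀∉M mate-a
                    {ia} {ib} {ja} {jb} ia-joins ib-joins ja-joins jb-joins =
  through-avoiding⇒removable mc (λ u v → avoid-e₀ (connected u v)) through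
  where
    open Edges G
    open EdgeDeletion G e₀
    ia≢e₀ : ia ≢ e₀
    ia≢e₀ = Joins-distinct ia-joins e₀-joins (≢-sym (Joins⇒≢ ja-joins))
    ja≢e₀ : ja ≢ e₀
    ja≢e₀ = Joins-distinct ja-joins (Joins-sym e₀-joins) (≢-sym (Joins⇒≢ ia-joins))
    -- an occurrence of e₀ in a walk is replaced by the detour through a
    avoid-e₀ : ∀ {u v} → Star (Adj G) u v → Star (Adj (deleteEdge G e₀)) u v
    avoid-e₀ ε = ε
    avoid-e₀ ((g , g-joins) ◅ rest) with ≡⊎≢ g e₀
    ... | inj₂ g≢e₀ = Adj-delete g≢e₀ g-joins ◅ avoid-e₀ rest
    ... | inj₁ refl with Joins-endpoints e₀-joins g-joins
    ... | inj₁ (refl , refl) =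
      Adj-delete ia≢e₀ ia-joins ◅ Adj-delete ja≢e₀ (Joins-sym ja-joins) ◅ avoid-e₀ rest
    ... | inj₂ (refl , refl) =
      Adj-delete ja≢e₀ ja-joins ◅ Adj-delete ia≢e₀ (Joins-sym ia-joins) ◅ avoid-e₀ rest
    through : ∀ f → f ≢ e₀ → PMThroughAvoiding G f e₀
    through f f≢e₀ with covered f
    ... | N , isN , f∈N with N e₀ in e₀∈N
    ... | false = N , isN , f∈N , e₀∈N
    ... | true = AlternatingWalk.start G N isN M isM e₀∈N e₀-joins f∈N f≢e₀ e₀∉M mate-a
                   ia-joins ib-joins ja-joins jb-joins

-- Complete subgraphs

-- The elements of Fin (2 + k) other than p and q.
others₂ : ∀ {k} {p q : Fin (suc (suc k))} → p ≢ q → Fin k → Fin (suc (suc k))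
others₂ {p = p} p≢q t = punchIn p (punchIn (punchOut p≢q) t)

module _ {k} {p q : Fin (suc (suc k))} (p≢q : p ≢ q) where

  others₂-≢ˡ : ∀ t → others₂ p≢q t ≢ p
  others₂-≢ˡ t = punchInᵢ≢i p _

  others₂-≢ʳ : ∀ t → others₂ p≢q t ≢ q
  others₂-≢ʳ t eq = punchInᵢ≢i (punchOut p≢q) t
    (punchIn-injective p _ _ (trans eq (sym (punchIn-punchOut p≢q))))

  others₂-injective : ∀ {s t} → others₂ p≢q s ≡ others₂ p≢q t → s ≡ t
  others₂-injective eq = punchIn-injective (punchOut p≢q) _ _ (punchIn-injective p _ _ eq)

  others₂-onto : ∀ r → r ≢ p → r ≢ q → ∃ λ t → others₂ p≢q t ≡ r
  others₂-onto r r≢p r≢q = punchOut q′≢r′ ,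
    trans (cong (punchIn p) (punchIn-punchOut q′≢r′)) (punchIn-punchOut (≢-sym r≢p))
    where
      q′≢r′ : punchOut p≢q ≢ punchOut (≢-sym r≢p)
      q′≢r′ eq = r≢q (trans (sym (punchIn-punchOut (≢-sym r≢p)))
                     (trans (cong (punchIn p) (sym eq)) (punchIn-punchOut p≢q)))

others₂-0≢1 : ∀ {k} {p q : Fin (suc (suc (suc (suc k))))} (p≢q : p ≢ q) →
              others₂ p≢q zero ≢ others₂ p≢q (suc zero)
others₂-0≢1 p≢q eq with others₂-injective p≢q eq
... | ()

avoid-three : ∀ {k} {i j l : Fin (suc (suc (suc (suc (suc k)))))} → i ≢ j → i ≢ l → j ≢ l →
  Σ (Fin _) λ a → Σ (Fin _) λ b → a ≢ b × (a ≢ i × a ≢ j × a ≢ l) × (b ≢ i × b ≢ j × b ≢ l)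
avoid-three {k} {i} {j} {l} i≢j i≢l j≢l with others₂-onto i≢j l (≢-sym i≢l) (≢-sym j≢l)
... | l′ , refl =
  pick zero , pick (suc zero) , (λ eq → 0≢1 (punchIn-injective l′ _ _ (others₂-injective i≢j eq))) ,
  (others₂-≢ˡ i≢j _ , others₂-≢ʳ i≢j _ , pick-≢ zero) ,
  (others₂-≢ˡ i≢j _ , others₂-≢ʳ i≢j _ , pick-≢ (suc zero))
  where
    pick : Fin (suc (suc k)) → Fin (suc (suc (suc (suc (suc k)))))
    pick t = others₂ i≢j (punchIn l′ t)
    pick-≢ : ∀ t → pick t ≢ others₂ i≢j l′
    pick-≢ t eq = punchInᵢ≢i l′ t (others₂-injective i≢j eq)
    0≢1 : zero {suc k} ≢ suc zero
    0≢1 ()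

module Complete {n m k} {G : Graph n m} (H : CompleteSubgraph G k) where
  open Edges G

  vtx-≢ : ∀ {x y} → x ≢ y → vtx H x ≢ vtx H y
  vtx-≢ {x} {y} x≢y eq = x≢y (vtx-inj H x y eq)

  removable-in-K4 : MatchingCovered G → ∀ {i j a b} (i≢j : i ≢ j) (a≢b : a ≢ b) →
    i ≢ a → i ≢ b → j ≢ a → j ≢ b → ∀ {M} → IsPerfectMatching G M →
    M (edge H a b a≢b) ≡ true → M (edge H i j i≢j) ≡ false → Removable G (edge H i j i≢j)
  removable-in-K4 mc {i} {j} {a} {b} i≢j a≢b i≢a i≢b j≢a j≢b isM ab∈M ij∉M =
    removable-by-chords mc (edge-joins H i j i≢j) isM ij∉M
      (PerfectMatching.∈⇒mate G _ isM ab∈M (edge-joins H a b a≢b))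
      (edge-joins H i a i≢a) (edge-joins H i b i≢b) (edge-joins H j a j≢a) (edge-joins H j b j≢b)

  adjacent-edges-removable : MatchingCovered G → k ≥ 5 →
    ∀ (i j l : Fin k) (p : i ≢ j) (q : i ≢ l) → j ≢ l →
    Removable G (edge H i j p) ⊎ Removable G (edge H i l q)
  adjacent-edges-removable mc (s≤s (s≤s (s≤s (s≤s (s≤s _))))) i j l i≢j i≢l j≢l
    with avoid-three i≢j i≢l j≢l
  ... | a , b , a≢b , (a≢i , a≢j , a≢l) , (b≢i , b≢j , b≢l) with proj₂ (proj₂ mc) (edge H a b a≢b)
  ... | M , isM , ab∈M with M (edge H i j i≢j) in M-ij
  ... | false =
    inj₁ (removable-in-K4 mc i≢j a≢b (≢-sym a≢i) (≢-sym b≢i) (≢-sym a≢j) (≢-sym b≢j) isM ab∈M M-ij)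
  ... | true =
    inj₂ (removable-in-K4 mc i≢l a≢b (≢-sym a≢i) (≢-sym b≢i) (≢-sym a≢l) (≢-sym b≢l) isM ab∈M il∉M)
    where
      il∉M : M (edge H i l i≢l) ≡ false
      il∉M = ¬-not λ il∈M → vtx-≢ j≢l (Joins-functional (edge-joins H i j i≢j)
        (subst (λ g → Joins G g (vtx H i) (vtx H l))
               (sym (PerfectMatching.unique G M isM M-ij il∈M (Joins⇒Incidentˡ (edge-joins H i j i≢j))
                                                          (Joins⇒Incidentˡ (edge-joins H i l i≢l))))
               (edge-joins H i l i≢l)))

induced-K5⇒complete : ∀ {n m} {G : Graph n m} → HasInducedK5 G → CompleteSubgraph G 5
induced-K5⇒complete {G = G} (f , f-inj , edges) = record
  { vtx = f ; vtx-inj = f-inj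
  ; edge = λ i j i≢j → proj₁ (edges i j i≢j)
  ; edge-joins = λ i j i≢j → proj₁ (proj₂ (edges i j i≢j))
  ; edge-sym = λ i j i≢j j≢i →
      sym (proj₂ (proj₂ (edges i j i≢j)) _ (Edges.Joins-sym G (proj₁ (proj₂ (edges j i j≢i))))) }

nonremovable⇒K5Free : ∀ {n m} {G : Graph n m} → MatchingCovered G → (∀ e → ¬ Removable G e) → K5Free G
nonremovable⇒K5Free mc nonremovable K5
  with Complete.adjacent-edges-removable (induced-K5⇒complete K5) mc ≤-refl
         zero (suc zero) (suc (suc zero)) (λ ()) (λ ()) (λ ())
... | inj₁ removable = nonremovable _ removable
... | inj₂ removable = nonremovable _ removable

module PendantEdge {n m k} {G : Graph n (suc m)} (H : CompleteSubgraph G k)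
  {i₀ : Fin k} {w : Fin n} (w∉H : ∀ i → vtx H i ≢ w)
  (only-w : ∀ x → Adj G (vtx H i₀) x → (∀ i → vtx H i ≢ x) → x ≡ w)
  {e : Fin (suc m)} (e-joins : Joins G e (vtx H i₀) w) (e-unique : ∀ e′ → Joins G e′ (vtx H i₀) w → e′ ≡ e)
  where
  open Edges G

  u : Fin n
  u = vtx H i₀

  e-outside : ∀ {t} → t ≢ i₀ → ¬ Incident G e (vtx H t)
  e-outside {t} t≢i₀ inc with Joins-Incident e-joins inc
  ... | inj₁ eq = t≢i₀ (vtx-inj H t i₀ eq)
  ... | inj₂ eq = w∉H t eq

  module _ {R} (isR : IsPerfectMatching G R) where
    open PerfectMatching G R isR

    mate-in-H : R e ≡ false → ∃ λ t → t ≢ i₀ × vtx H t ≡ mate u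
    mate-in-H e∉R with any? (λ t → vtx H t ≟ mate u)
    ... | yes (t , eq) = t , (λ { refl → mate-≢ u (sym eq) }) , eq
    ... | no outside = ⊥-elim (true≢false (subst (λ g → R g ≡ true) (e-unique _ to-w) (edgeAt-∈ u)) e∉R)
      where
        to-w : Joins G (edgeAt u) u w
        to-w = subst (Joins G (edgeAt u) u)
                     (only-w (mate u) (edgeAt u , mate-joins u) (λ t eq → outside (t , eq))) (mate-joins u)

module TrianglePendant {n m} {G : Graph n (suc m)} (H : CompleteSubgraph G 3)
  {i₀ : Fin 3} {w : Fin n} (w∉H : ∀ i → vtx H i ≢ w)
  (only-w : ∀ x → Adj G (vtx H i₀) x → (∀ i → vtx H i ≢ x) → x ≡ w)
  {e : Fin (suc m)} (e-joins : Joins G e (vtx H i₀) w) (e-unique : ∀ e′ → Joins G e′ (vtx H i₀) w → e′ ≡ e)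
  where
  open Edges G
  open EdgeDeletion G e
  open PendantEdge H w∉H only-w e-joins e-unique

  a b : Fin 3
  a = punchIn i₀ zero
  b = punchIn i₀ (suc zero)

  a≢b : a ≢ b
  a≢b eq with punchIn-injective i₀ _ _ eq
  ... | ()

  g : Fin (suc m)
  g = edge H a b a≢b

  g-at : ∀ {t} → t ≢ i₀ → Incident G g (vtx H t)
  g-at t≢i₀ with punchOut (≢-sym t≢i₀) | punchIn-punchOut (≢-sym t≢i₀)
  ... | zero | refl = Joins⇒Incidentˡ (edge-joins H a b a≢b)
  ... | suc zero | refl = Joins⇒Incidentʳ (edge-joins H a b a≢b)

  g-not-at-u : ¬ Incident G g u
  g-not-at-u inc with Joins-Incident (edge-joins H a b a≢b) inc
  ... | inj₁ eq = punchInᵢ≢i i₀ _ (sym (vtx-inj H i₀ a eq))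
  ... | inj₂ eq = punchInᵢ≢i i₀ _ (sym (vtx-inj H i₀ b eq))

  g≢e : g ≢ e
  g≢e g≡e = e-outside (punchInᵢ≢i i₀ _)
    (subst (λ z → Incident G z (vtx H a)) g≡e (Joins⇒Incidentˡ (edge-joins H a b a≢b)))

  -- A perfect matching through g, the edge opposite u, cannot match u inside the triangle.
  nonremovable : ¬ Removable G e
  nonremovable removable with removable⇒through-avoiding removable g g≢e
  ... | R , isR , g∈R , e∉R with mate-in-H isR e∉R
  ... | t , t≢i₀ , vtx-t = g-not-at-u (subst (λ z → Incident G z u) (sym g≡edgeAt) (edgeAt-incident u))
    where
      open PerfectMatching G R isR
      g≡edgeAt : g ≡ edgeAt u
      g≡edgeAt = unique g∈R (edgeAt-∈ u) (g-at t≢i₀)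
                        (subst (Incident G (edgeAt u)) (sym vtx-t) (Joins⇒Incidentʳ (mate-joins u)))

module K4Pendant {n m} {G : Graph n (suc m)} (mc : MatchingCovered G) (H : CompleteSubgraph G 4)
  (H-nonremovable : ∀ i j (p : i ≢ j) → ¬ Removable G (edge H i j p))
  {i₀ : Fin 4} {w : Fin n} (w∉H : ∀ i → vtx H i ≢ w)
  (only-w : ∀ x → Adj G (vtx H i₀) x → (∀ i → vtx H i ≢ x) → x ≡ w)
  {e : Fin (suc m)} (e-joins : Joins G e (vtx H i₀) w) (e-unique : ∀ e′ → Joins G e′ (vtx H i₀) w → e′ ≡ e)
  where
  open Edges G
  open Complete H
  open EdgeDeletion G e
  open PendantEdge H w∉H only-w e-joins e-unique

  -- Otherwise the opposite edge would be removable.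
  opposite-edge-∈ : ∀ {Q} → IsPerfectMatching G Q → ∀ {p q} (p≢q : p ≢ q) → Q (edge H p q p≢q) ≡ true →
                    Q (edge H (others₂ p≢q zero) (others₂ p≢q (suc zero)) (others₂-0≢1 p≢q)) ≡ true
  opposite-edge-∈ isQ p≢q pq∈Q = ¬-not λ rs∉Q →
    H-nonremovable _ _ _ (removable-in-K4 mc (others₂-0≢1 p≢q) p≢q
      (others₂-≢ˡ p≢q _) (others₂-≢ʳ p≢q _) (others₂-≢ˡ p≢q _) (others₂-≢ʳ p≢q _) isQ pq∈Q rs∉Q)

  matched-in-K4 : ∀ {Q} → IsPerfectMatching G Q → ∀ {p q} (p≢q : p ≢ q) → Q (edge H p q p≢q) ≡ true →
                  ∀ {t} → t ≢ p → t ≢ q → ∃ λ t′ → Σ (t ≢ t′) λ t≢t′ → Q (edge H t t′ t≢t′) ≡ true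
  matched-in-K4 {Q} isQ {p} {q} p≢q pq∈Q {t} t≢p t≢q with others₂-onto p≢q t t≢p t≢q
  ... | zero , refl = _ , others₂-0≢1 p≢q , opposite-edge-∈ isQ p≢q pq∈Q
  ... | suc zero , refl =
    _ , ≢-sym (others₂-0≢1 p≢q) ,
    trans (cong Q (edge-sym H _ _ (≢-sym (others₂-0≢1 p≢q)) (others₂-0≢1 p≢q))) (opposite-edge-∈ isQ p≢q pq∈Q)

  a : Fin 4
  a = punchIn i₀ zero

  a≢i₀ : a ≢ i₀
  a≢i₀ = punchInᵢ≢i i₀ _

  module _ {P} (isP : IsPerfectMatching G P) (e∈P : P e ≡ true) where
    private module 𝑃 = PerfectMatching G P isP

    A a′ : Fin n
    A = vtx H a
    a′ = 𝑃.mate A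

    h : Fin (suc m)
    h = 𝑃.edgeAt A

    h-joins : Joins G h A a′
    h-joins = 𝑃.mate-joins A

    -- Otherwise exchanging h for the H-edge aa′ yields a perfect matching through e that
    -- uses an edge of H at u.
    a′∉H : ∀ t → vtx H t ≢ a′
    a′∉H t eq with ≡⊎≢ t i₀ | ≡⊎≢ t a
    ... | inj₁ refl | _ = e-outside a≢i₀ (subst (λ z → Incident G z A) h≡e (Joins⇒Incidentˡ h-joins))
      where
        h≡e : h ≡ e
        h≡e = 𝑃.unique (𝑃.edgeAt-∈ A) e∈P (subst (Incident G h) (sym eq) (Joins⇒Incidentʳ h-joins))
                           (Joins⇒Incidentˡ e-joins)
    ... | inj₂ _ | inj₁ refl = 𝑃.mate-≢ A (sym eq)
    ... | inj₂ t≢i₀ | inj₂ t≢a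
      with exchange-parallel {G = G} {Q = P} isP (subst (Joins G _ A) eq (edge-joins H a t (≢-sym t≢a)))
    ... | P′ , isP′ , at∈P′ , keeps with matched-in-K4 isP′ (≢-sym t≢a) at∈P′ (≢-sym a≢i₀) (≢-sym t≢i₀)
    ... | t′ , i₀≢t′ , i₀t′∈P′ =
      e-outside (≢-sym i₀≢t′)
        (subst (λ z → Incident G z (vtx H t′)) i₀t′≡e (Joins⇒Incidentʳ (edge-joins H i₀ t′ i₀≢t′)))
      where
        e∈P′ : P′ e ≡ true
        e∈P′ = trans (keeps e (e-outside a≢i₀) (subst (λ z → ¬ Incident G e z) eq (e-outside t≢i₀))) e∈P
        i₀t′≡e : edge H i₀ t′ i₀≢t′ ≡ e
        i₀t′≡e = PerfectMatching.unique G _ isP′ i₀t′∈P′ e∈P′ (Joins⇒Incidentˡ (edge-joins H i₀ t′ i₀≢t′))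
                                                          (Joins⇒Incidentˡ e-joins)

    h-avoids : ∀ {t} → t ≢ a → ¬ Incident G h (vtx H t)
    h-avoids {t} t≢a inc = [ (λ eq → t≢a (vtx-inj H t a eq)) , a′∉H t ] (Joins-Incident h-joins inc)

    h≢e : h ≢ e
    h≢e h≡e = e-outside a≢i₀ (subst (λ z → Incident G z A) h≡e (Joins⇒Incidentˡ h-joins))

    -- A perfect matching through h avoiding e matches u inside H; exchanging that edge for
    -- an H-edge forces h to join a to a vertex of H.
    nonremovable-from : ¬ Removable G e
    nonremovable-from removable with removable⇒through-avoiding removable h h≢e
    ... | Q , isQ , h∈Q , e∉Q with mate-in-H isQ e∉Q
    ... | t , t≢i₀ , vtx-t with ≡⊎≢ t a
    ... | inj₁ refl = h-avoids (≢-sym a≢i₀) (subst (λ z → Incident G z u) (sym h≡) (Q.edgeAt-incident u))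
      where
        module Q = PerfectMatching G Q isQ
        h≡ : h ≡ Q.edgeAt u
        h≡ = Q.unique h∈Q (Q.edgeAt-∈ u) (Joins⇒Incidentˡ h-joins)
                      (subst (Incident G (Q.edgeAt u)) (sym vtx-t) (Joins⇒Incidentʳ (Q.mate-joins u)))
    ... | inj₂ t≢a
      with exchange-parallel {G = G} {Q = Q} isQ (subst (Joins G _ u) vtx-t (edge-joins H i₀ t (≢-sym t≢i₀)))
    ... | Q′ , isQ′ , i₀t∈Q′ , keeps with matched-in-K4 isQ′ (≢-sym t≢i₀) i₀t∈Q′ a≢i₀ (≢-sym t≢a)
    ... | t′ , a≢t′ , at′∈Q′ =
      a′∉H t′ (Joins-functional (subst (λ z → Joins G z A (vtx H t′)) at′≡h (edge-joins H a t′ a≢t′)) h-joins)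
      where
        h∈Q′ : Q′ h ≡ true
        h∈Q′ = trans (keeps h (h-avoids (≢-sym a≢i₀)) (subst (λ z → ¬ Incident G h z) vtx-t (h-avoids t≢a)))
                     h∈Q
        at′≡h : edge H a t′ a≢t′ ≡ h
        at′≡h = PerfectMatching.unique G _ isQ′ at′∈Q′ h∈Q′ (Joins⇒Incidentˡ (edge-joins H a t′ a≢t′))
                                                        (Joins⇒Incidentˡ h-joins)

  nonremovable : ¬ Removable G e
  nonremovable with proj₂ (proj₂ mc) e
  ... | P , isP , e∈P = nonremovable-from isP e∈P

pendant-nonremovable : ∀ {n m : ℕ} (G : Graph n m) → MatchingCovered G →
  (k : ℕ) (H : CompleteSubgraph G k) (i₀ : Fin k) (w : Fin n) →
  (∀ i → vtx H i ≢ w) →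
  Adj G (vtx H i₀) w →
  (∀ x → Adj G (vtx H i₀) x → (∀ i → vtx H i ≢ x) → x ≡ w) →
  ((k ≡ 4 × (∀ i j (p : i ≢ j) → ¬ Removable G (edge H i j p))) ⊎ k ≡ 3) →
  ∀ (e : Fin m) → Joins G e (vtx H i₀) w →
  (∀ e′ → Joins G e′ (vtx H i₀) w → e′ ≡ e) →
  ¬ Removable G e
pendant-nonremovable {m = zero} _ _ _ _ _ _ _ _ _ _ ()
-- The hypothesis that u is adjacent to w is implied by e joining them.
pendant-nonremovable {m = suc m} G mc .4 H i₀ w w∉H _ only-w (inj₁ (refl , H-nonremovable)) e e-joins
                     e-unique =
  K4Pendant.nonremovable mc H H-nonremovable w∉H only-w e-joins e-unique
pendant-nonremovable {m = suc m} G mc .3 H i₀ w w∉H _ only-w (inj₂ refl) e e-joins e-unique =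
  TrianglePendant.nonremovable H w∉H only-w e-joins e-unique

lemma2p9 :
    ∀ {n m : ℕ} (G : Graph n m) → MatchingCovered G →
      ((k : ℕ) (H : CompleteSubgraph G k) → k ≥ 5 →
        ∀ (i j l : Fin k) (p : i ≢ j) (q : i ≢ l) → j ≢ l →
          Removable G (edge H i j p) ⊎ Removable G (edge H i l q))
      × ((∀ e → ¬ Removable G e) → K5Free G)
      × ((k : ℕ) (H : CompleteSubgraph G k) (i₀ : Fin k) (w : Fin n) →
          (∀ i → vtx H i ≢ w) →
          Adj G (vtx H i₀) w →
          (∀ x → Adj G (vtx H i₀) x → (∀ i → vtx H i ≢ x) → x ≡ w) →
          ((k ≡ 4 × (∀ i j (p : i ≢ j) → ¬ Removable G (edge H i j p))) ⊎ k ≡ 3) →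
          ∀ (e : Fin m) → Joins G e (vtx H i₀) w →
          (∀ e′ → Joins G e′ (vtx H i₀) w → e′ ≡ e) →
          ¬ Removable G e)
lemma2p9 G mc =
  (λ k H → Complete.adjacent-edges-removable H mc) ,
  nonremovable⇒K5Free mc ,
  pendant-nonremovable G mc
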